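{- For all $k\ge1$, $Q_{132}^{(k,0,\emptyset,0)}(t,0)=Q_{132}^{(k,0,0,0)}(t,0)$; that is, for every $n$, the number of $\sigma\in S_n(132)$ with $\mathrm{mmp}^{(k,0,\emptyset,0)}(\sigma)=0$ equals the number of $\sigma\in S_n(132)$ with $\mathrm{mmp}^{(k,0,0,0)}(\sigma)=0$.
   Context: For $\sigma=\sigma_1\cdots\sigma_n\in S_n$: $\mathrm{mmp}^{(k,0,0,0)}(\sigma)$ is the number of positions $i$ such that there are at least $k$ indices $j>i$ with $\sigma_j>\sigma_i$; $\mathrm{mmp}^{(k,0,\emptyset,0)}(\sigma)$ is the number of positions $i$ such that there are at least $k$ indices $j>i$ with $\sigma_j>\sigma_i$ and no $j<i$ with $\sigma_j<\sigma_i$. $S_n(132)$ is the set of 132-avoiding permutations of $[n]$. For a pattern $p$, $Q_{132}^{p}(t,x)=1+\sum_{n\ge1}t^n\sum_{\sigma\in S_n(132)}x^{\mathrm{mmp}^{p}(\sigma)}$. -}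

module Defs where

open import Data.Nat using (ℕ; zero; suc; _<ᵇ_; _≡ᵇ_; _≤ᵇ_)
open import Data.Bool using (Bool; true; false; _∧_; _∨_; not; if_then_else_)
open import Data.List using (List; []; _∷_; map; concatMap; filter; length; upTo)
open import Data.Bool.ListAction using (any)
open import Data.Bool.Properties using (T?)
open import Function using (_∘_)

-- A permutation σ = σ₁⋯σₙ of [n] is represented by its one-line notation,
-- as the list of values (σ₁ − 1, …, σₙ − 1) ∈ {0,…,n−1}ⁿ with distinct entries.
-- Only relative order of values matters for all statistics below.

words : ℕ → ℕ → List (List ℕ)
words zero    m = [] ∷ []
words (suc l) m = concatMap (λ a → map (a ∷_) (words l m)) (upTo m)

distinct : List ℕ → Bool
distinct []       = true
distinct (x ∷ xs) = not (any (x ≡ᵇ_) xs) ∧ distinct xs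

perms : ℕ → List (List ℕ)
perms n = filter (T? ∘ distinct) (words n n)

hasBC : ℕ → List ℕ → Bool
hasBC a []       = false
hasBC a (b ∷ xs) = ((a <ᵇ b) ∧ any (λ c → (a <ᵇ c) ∧ (c <ᵇ b)) xs) ∨ hasBC a xs

contains132 : List ℕ → Bool
contains132 []       = false
contains132 (a ∷ xs) = hasBC a xs ∨ contains132 xs

perms132 : ℕ → List (List ℕ)
perms132 n = filter (T? ∘ (not ∘ contains132)) (perms n)

countGreater : ℕ → List ℕ → ℕ
countGreater x ys = length (filter (T? ∘ (x <ᵇ_)) ys)

mmpK000 : ℕ → List ℕ → ℕ
mmpK000 k []       = 0
mmpK000 k (x ∷ xs) = (if k ≤ᵇ countGreater x xs then 1 else 0) Data.Nat.+ mmpK000 k xs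

mmpK0E0-aux : ℕ → List ℕ → List ℕ → ℕ
mmpK0E0-aux k pre []       = 0
mmpK0E0-aux k pre (x ∷ xs) =
  (if (k ≤ᵇ countGreater x xs) ∧ not (any (_<ᵇ x) pre) then 1 else 0)
    Data.Nat.+ mmpK0E0-aux k (x ∷ pre) xs

mmpK0E0 : ℕ → List ℕ → ℕ
mmpK0E0 k σ = mmpK0E0-aux k [] σ

count132Zero : (List ℕ → ℕ) → ℕ → ℕ
count132Zero stat n = length (filter (T? ∘ (λ σ → stat σ ≡ᵇ 0)) (perms132 n))

module Submission where

-- For every word σ (not only 132-avoiding permutations) and
-- every k, the statistics mmp^(k,0,∅,0) and mmp^(k,0,0,0) vanish on σ
-- simultaneously, so the two zero-counts are lengths of the same filtered
-- list.  One direction is immediate: every position counted by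
-- mmp^(k,0,∅,0) is counted by mmp^(k,0,0,0), i.e. the former is bounded by
-- the latter.  For the other direction, let i be the FIRST position with at
-- least k larger entries after it.  If some earlier σⱼ were smaller than σᵢ,
-- every entry exceeding σᵢ after i would also exceed σⱼ and lie after j, so
-- j would have at least k larger entries after it, contradicting the choice
-- of i.  Hence σᵢ is a left-to-right minimum and is counted by
-- mmp^(k,0,∅,0).

open import Defs
open import Data.Nat using (ℕ; _≥_; _<_; _≤_; _<ᵇ_; _≤ᵇ_; _≡ᵇ_; s≤s; z≤n)
open import Data.Nat.Properties
  using (<ᵇ-reflects-<; ≤ᵇ-reflects-≤; ≡ᵇ⇒≡; ≡⇒≡ᵇ; ≤-refl; ≤-trans; ≤-<-trans;
         <-trans; <⇒≱; ≰⇒>; n≤1+n; m≤n⇒m≤1+n; n≤0⇒n≡0; 1+n≢0)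
open import Data.Bool using (T; true; false)
open import Data.Bool.ListAction using (any)
open import Data.Bool.Properties using (T?)
open import Data.List using (List; []; _∷_; length)
open import Data.List.Properties using (filter-≐)
open import Data.List.Relation.Unary.All as All using (All; []; _∷_)
open import Data.Product using (_,_)
open import Relation.Nullary using (¬_; contradiction)
open import Relation.Nullary.Reflects using (ofʸ; ofⁿ)
open import Relation.Unary using (_≐_)
open import Relation.Binary.PropositionalEquality using (_≡_; refl; cong; subst)

countGreater-cons : ∀ y x xs → countGreater y xs ≤ countGreater y (x ∷ xs)
countGreater-cons y x xs with y <ᵇ x
... | true  = n≤1+n _
... | false = ≤-refl

countGreater-antitone : ∀ {y x} xs → y < x → countGreater x xs ≤ countGreater y xs
countGreater-antitone [] y<x = z≤n
countGreater-antitone {y} {x} (z ∷ zs) y<x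
  with x <ᵇ z | <ᵇ-reflects-< x z | y <ᵇ z | <ᵇ-reflects-< y z
... | true  | _       | true  | _       = s≤s (countGreater-antitone zs y<x)
... | true  | ofʸ x<z | false | ofⁿ y≮z = contradiction (<-trans y<x x<z) y≮z
... | false | _       | true  | _       = m≤n⇒m≤1+n (countGreater-antitone zs y<x)
... | false | _       | false | _       = countGreater-antitone zs y<x

-- An entry y below x, placed before x, sees every entry above x that
-- follows x, so it inherits x's saturation.
smaller-before-saturated : ∀ {k y x} xs → y < x →
  k ≤ countGreater x xs → k ≤ countGreater y (x ∷ xs)
smaller-before-saturated {y = y} {x} xs y<x k≤x =
  ≤-trans k≤x (≤-trans (countGreater-antitone xs y<x) (countGreater-cons y x xs))

<ᵇ-false : ∀ {m n} → ¬ m < n → (m <ᵇ n) ≡ false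
<ᵇ-false {m} {n} m≮n with m <ᵇ n | <ᵇ-reflects-< m n
... | true  | ofʸ m<n = contradiction m<n m≮n
... | false | _       = refl

no-smaller-before : ∀ {k x xs} pre →
  All (λ y → countGreater y (x ∷ xs) < k) pre → k ≤ countGreater x xs →
  any (_<ᵇ x) pre ≡ false
no-smaller-before [] [] _ = refl
no-smaller-before {x = x} {xs} (y ∷ pre) (y-unsat ∷ pre-unsat) k≤x
  rewrite <ᵇ-false (λ y<x → <⇒≱ y-unsat (smaller-before-saturated xs y<x k≤x)) =
  no-smaller-before {x = x} {xs} pre pre-unsat k≤x

module _ (k : ℕ) where

  mmpK0E0-aux≤mmpK000 : ∀ pre xs → mmpK0E0-aux k pre xs ≤ mmpK000 k xs
  mmpK0E0-aux≤mmpK000 pre [] = z≤n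
  mmpK0E0-aux≤mmpK000 pre (x ∷ xs) with k ≤ᵇ countGreater x xs | any (_<ᵇ x) pre
  ... | false | _     = mmpK0E0-aux≤mmpK000 (x ∷ pre) xs
  ... | true  | true  = m≤n⇒m≤1+n (mmpK0E0-aux≤mmpK000 (x ∷ pre) xs)
  ... | true  | false = s≤s (mmpK0E0-aux≤mmpK000 (x ∷ pre) xs)

  -- Converse for vanishing, under the invariant that no prefix entry has k
  -- larger entries in the remaining suffix; the first position with k larger
  -- entries would be counted by the restricted statistic.
  mmpK0E0-aux-zero⇒mmpK000-zero : ∀ pre xs →
    All (λ y → countGreater y xs < k) pre →
    mmpK0E0-aux k pre xs ≡ 0 → mmpK000 k xs ≡ 0
  mmpK0E0-aux-zero⇒mmpK000-zero pre [] _ _ = refl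
  mmpK0E0-aux-zero⇒mmpK000-zero pre (x ∷ xs) pre-unsat vanishes
    with k ≤ᵇ countGreater x xs | ≤ᵇ-reflects-≤ k (countGreater x xs)
  ... | false | ofⁿ k≰x =
    mmpK0E0-aux-zero⇒mmpK000-zero (x ∷ pre) xs (≰⇒> k≰x ∷ All.map shrink pre-unsat) vanishes
    where
    shrink : ∀ {y} → countGreater y (x ∷ xs) < k → countGreater y xs < k
    shrink {y} = ≤-<-trans (countGreater-cons y x xs)
  ... | true  | ofʸ k≤x
    with any (_<ᵇ x) pre | no-smaller-before {x = x} {xs} pre pre-unsat k≤x
  ... | .false | refl = contradiction vanishes 1+n≢0

  zero-sets-agree : (λ σ → T (mmpK0E0 k σ ≡ᵇ 0)) ≐ (λ σ → T (mmpK000 k σ ≡ᵇ 0))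
  zero-sets-agree = (λ {σ} → restricted⇒full {σ}) , (λ {σ} → full⇒restricted {σ})
    where
    restricted⇒full : ∀ {σ} → T (mmpK0E0 k σ ≡ᵇ 0) → T (mmpK000 k σ ≡ᵇ 0)
    restricted⇒full {σ} z =
      ≡⇒≡ᵇ _ 0 (mmpK0E0-aux-zero⇒mmpK000-zero [] σ [] (≡ᵇ⇒≡ _ 0 z))
    full⇒restricted : ∀ {σ} → T (mmpK000 k σ ≡ᵇ 0) → T (mmpK0E0 k σ ≡ᵇ 0)
    full⇒restricted {σ} z =
      ≡⇒≡ᵇ _ 0 (n≤0⇒n≡0 (subst (mmpK0E0 k σ ≤_) (≡ᵇ⇒≡ _ 0 z) (mmpK0E0-aux≤mmpK000 [] σ)))

proposition23 : (k : ℕ) → k ≥ 1 → (n : ℕ) →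
    count132Zero (mmpK0E0 k) n ≡ count132Zero (mmpK000 k) n
proposition23 k _ n =
  cong length (filter-≐ (λ σ → T? (mmpK0E0 k σ ≡ᵇ 0)) (λ σ → T? (mmpK000 k σ ≡ᵇ 0))
                        (zero-sets-agree k) (perms132 n))
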